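{- Let $X,Y$ be strings over $\Sigma$, $k\ge0$ and $\ell\ge1$ integers, $\mathcal{F}$ and $N$ as in the context. If $\mathrm{LCF}_k(X,Y)\ge\ell$, then $$\mathrm{LCF}_k(X,Y)=\max_{k_1+k_2=k}\mathrm{maxPairLCP}\big(\mathrm{Pairs}^{(k,k_1)}_\ell(X),\mathrm{Pairs}^{(k,k_2)}_\ell(Y)\big),$$ where $k_1,k_2$ range over non-negative half-integers.
   Context: Strings are indexed from 1; $U^R$ is the reversal, $U[..i]=U[1..i]$, $U[i..]=U[i..|U|]$. $\Sigma_\$=\Sigma\cup\{\$\}$, $\$\notin\Sigma$. $d_H$ is Hamming distance of equal-length strings; $\mathrm{LCP}$ is longest common prefix length; $\mathrm{LCP}_d(U,V)=\max\{p\le|U|,|V|: d_H(U[1..p],V[1..p])\le d\}$. $\mathrm{LCF}_k(X,Y)$ is the maximum $m$ such that some length-$m$ factors of $X$ and $Y$ have Hamming distance at most $k$. A set $S(d)\subseteq\mathbb{Z}_+$ is a $d$-cover if there is a function $h$ with $0\le h(i,j)<d$ and $i+h(i,j),j+h(i,j)\in S(d)$ for all $i,j\in\mathbb{Z}_+$; a fixed $\ell$-cover $S(\ell)$ is used and $\mathrm{Pairs}_\ell(U)=\{((U[..i-1])^R,U[i..]): i\in S(\ell)\cap[1..|U|]\}$. $\mathcal{F}$ is the family of strings occurring as components of pairs in $\mathrm{Pairs}_\ell(X)\cup\mathrm{Pairs}_\ell(Y)$. For $U,V\in\Sigma^*$ and integer $d\ge0$, $U',V'\in\Sigma_\$^*$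 form a $(U,V)_d$-pair if $|U'|=|U|$, $|V'|=|V|$; for each $i$ with $i>\mathrm{LCP}_d(U,V)$ or $U[i]=V[i]$, $U'[i]=U[i]$, $V'[i]=V[i]$; otherwise $U'[i]=V'[i]\in\{U[i],V[i],\$\}$. $(N(F))_{F\in\mathcal{F}}$, $N(F)\subseteq\Sigma_\$^*$, is a fixed $k$-complete family: for all $U,V\in\mathcal{F}$, $0\le d\le k$, there is a $(U,V)_d$-pair $(U',V')$ with $U'\in N(U)$, $V'\in N(V)$. $N_d(F)=\{F'\in N(F): |F'|=|F|,\ d_H(F,F')\le d\}$ and, for half-integer $0\le d'\le d$, $N_{d,d'}(F)=\{F'\in N_d(F): d_H(F,F')-\frac12\#_\$(F')\le d'\}$, $\#_\$$ counting $\$$'s. For $S\in\{X,Y\}$ and half-integer $0\le k'\le k$, $\mathrm{Pairs}^{(k,k')}_\ell(S)=\bigcup_{(U_1,U_2)\in\mathrm{Pairs}_\ell(S)}\{(U_1',U_2'): U_i'\in N_{d_i,d_i'}(U_i),\ k=d_1+d_2,\ k'=d_1'+d_2'\}$, with $d_i$ non-negative integers and $d_i'$ half-integers, $0\le d_i'\le d_i$. $\mathrm{maxPairLCP}(\mathcal{P},\mathcal{Q})=\max\{\mathrm{LCP}(P_1,Q_1)+\mathrm{LCP}(P_2,Q_2): (P_1,P_2)\in\mathcal{P},(Q_1,Q_2)\in\mathcal{Q}\}$. A half-integer is an element of $\frac12\mathbb{Z}$. -}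

module Defs where

open import Data.Nat using (ℕ; zero; suc; _+_; _*_; _∸_; _≤_; _<_)
open import Data.List using (List; []; _∷_; length; take; drop; reverse; map)
open import Data.Maybe using (Maybe; just; nothing)
import Data.Maybe as M
import Data.Maybe.Properties as MP
open import Data.Product using (Σ; _×_; _,_; proj₁; proj₂; ∃; ∃-syntax)
open import Data.Sum using (_⊎_)
open import Relation.Binary.PropositionalEquality using (_≡_; _≢_)
open import Relation.Binary.Definitions using (DecidableEquality)
open import Relation.Nullary using (yes; no)

IsMax : (ℕ → Set) → ℕ → Set
IsMax P L = P L × (∀ m → P m → m ≤ L)

-- 0-indexed partial lookup (position i here is position i+1 in the paper)
at : {A : Set} → List A → ℕ → Maybe A
at []       _       = nothing
at (a ∷ _)  zero    = just a
at (_ ∷ as) (suc i) = at as i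

-- Hamming distance (number of mismatching positions; used on equal-length strings)
dH : {A : Set} → DecidableEquality A → List A → List A → ℕ
dH eq []       _        = 0
dH eq (_ ∷ _)  []       = 0
dH eq (a ∷ as) (b ∷ bs) with eq a b
... | yes _ = dH eq as bs
... | no  _ = suc (dH eq as bs)

LCP : {A : Set} → DecidableEquality A → List A → List A → ℕ
LCP eq []       _        = 0
LCP eq (_ ∷ _)  []       = 0
LCP eq (a ∷ as) (b ∷ bs) with eq a b
... | yes _ = suc (LCP eq as bs)
... | no  _ = 0

-- number of $ symbols ($ is represented by nothing in Σ_$ = Maybe Σ)
#$ : {A : Set} → List (Maybe A) → ℕ
#$ []             = 0
#$ (nothing ∷ xs) = suc (#$ xs)
#$ (just _ ∷ xs)  = #$ xs

IsCover : ℕ → (ℕ → Set) → Set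
IsCover d S = Σ (ℕ → ℕ → ℕ) λ h → ∀ i j → 1 ≤ i → 1 ≤ j →
  h i j < d × S (i + h i j) × S (j + h i j)

module _ {Alph : Set} (_≟_ : DecidableEquality Alph) where

  Str : Set
  Str = List Alph

  Str$ : Set
  Str$ = List (Maybe Alph)

  _≟$_ : DecidableEquality (Maybe Alph)
  _≟$_ = MP.≡-dec _≟_

  IsLCPd : ℕ → Str → Str → ℕ → Set
  IsLCPd d U V = IsMax (λ p → p ≤ length U × p ≤ length V ×
                         dH _≟_ (take p U) (take p V) ≤ d)

  IsDPair : Str → Str → ℕ → Str$ → Str$ → Set
  IsDPair U V d U' V' =
    length U' ≡ length U × length V' ≡ length V ×
    Σ ℕ λ p → IsLCPd d U V p ×
      (∀ i → (p ≤ i ⊎ at U i ≡ at V i) →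
         at U' i ≡ M.map just (at U i) × at V' i ≡ M.map just (at V i)) ×
      (∀ i → i < p → at U i ≢ at V i →
         at U' i ≡ at V' i ×
         (at U' i ≡ M.map just (at U i) ⊎ at U' i ≡ M.map just (at V i) ⊎ at U' i ≡ just nothing))

  -- membership in Pairs_ℓ(U) for the cover S (positions i are 1-indexed)
  InPairs : (ℕ → Set) → Str → Str × Str → Set
  InPairs S U P = Σ ℕ λ i → S i × 1 ≤ i × i ≤ length U ×
    P ≡ (reverse (take (i ∸ 1) U) , drop (i ∸ 1) U)

  InF : (ℕ → Set) → Str → Str → Str → Set
  InF S X Y F = Σ (Str × Str) λ P → (InPairs S X P ⊎ InPairs S Y P) ×
    (proj₁ P ≡ F ⊎ proj₂ P ≡ F)

  -- N is a k-complete family (N F F' means F' ∈ N(F))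
  KComplete : (ℕ → Set) → Str → Str → ℕ → (Str → Str$ → Set) → Set
  KComplete S X Y k N = ∀ U V → InF S X Y U → InF S X Y V → ∀ d → d ≤ k →
    Σ Str$ λ U' → Σ Str$ λ V' → IsDPair U V d U' V' × N U U' × N V V'

  -- F' ∈ N_{d,d'}(F), where the half-integer d' is given doubled: e = 2d'
  InNdd : (Str → Str$ → Set) → ℕ → ℕ → Str → Str$ → Set
  InNdd N d e F F' = N F F' × length F' ≡ length F ×
    dH _≟$_ (map just F) F' ≤ d ×
    2 * dH _≟$_ (map just F) F' ≤ e + #$ F'

  -- membership in Pairs^{(k,k')}_ℓ(S), with the half-integer k' given doubled: e = 2k'
  InPairsK : (ℕ → Set) → (Str → Str$ → Set) → Str → ℕ → ℕ → Str$ × Str$ → Set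
  InPairsK S N T k e Q = Σ Str λ U₁ → Σ Str λ U₂ → InPairs S T (U₁ , U₂) ×
    Σ ℕ λ d₁ → Σ ℕ λ d₂ → Σ ℕ λ e₁ → Σ ℕ λ e₂ →
      d₁ + d₂ ≡ k × e₁ + e₂ ≡ e × e₁ ≤ 2 * d₁ × e₂ ≤ 2 * d₂ ×
      InNdd N d₁ e₁ U₁ (proj₁ Q) × InNdd N d₂ e₂ U₂ (proj₂ Q)

  -- m is one of the values LCP(P₁,Q₁)+LCP(P₂,Q₂) over k₁+k₂=k (k_i = h_i/2) and pairs
  PairValue : (ℕ → Set) → (Str → Str$ → Set) → Str → Str → ℕ → ℕ → Set
  PairValue S N X Y k m = Σ ℕ λ h₁ → Σ ℕ λ h₂ → h₁ + h₂ ≡ 2 * k ×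
    Σ (Str$ × Str$) λ P → Σ (Str$ × Str$) λ Q →
      InPairsK S N X k h₁ P × InPairsK S N Y k h₂ Q ×
      m ≡ LCP _≟$_ (proj₁ P) (proj₁ Q) + LCP _≟$_ (proj₂ P) (proj₂ Q)

  HasCommonFactor : ℕ → Str → Str → ℕ → Set
  HasCommonFactor k X Y m = Σ ℕ λ i → Σ ℕ λ j → i + m ≤ length X × j + m ≤ length Y ×
    dH _≟_ (take m (drop i X)) (take m (drop j Y)) ≤ k

module Submission where

-- A pair of Pairs_ℓ(T) consists of the two arms of T at a split point n: the reversed prefix
-- and the suffix.  A window of length a + b holding n at offset a is the first a symbols of
-- the left arm followed by the first b of the right arm, so Hamming distances of windows split
-- into left and right parts (window-dH).  After these list and distance facts, the file proves
--  * the upper bound (pairValue⇒commonFactor): substitutes within their budgets hide a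
--    mismatch under a common prefix only by paying two edits or two $'s (lcp-cost), so the
--    windows delimited by the two LCPs form a common factor with at most k mismatches;
--  * the lower bound (commonFactor-attained): the cover cuts an optimal pair of windows at a
--    common offset t < ℓ ≤ L at positions of S; k-completeness gives (U,V)_d-pairs for the
--    arms, which agree up to LCP_d(U,V) and split the budget 2d (dpair-split).
-- The theorem squeezes L between the two bounds.

open import Defs
open import Data.Nat using (ℕ; zero; suc; _+_; _*_; _∸_; _≤_; _<_; z≤n; s≤s)
open import Data.Nat.Properties
open import Data.Nat.Tactic.RingSolver using (solve-∀)
open import Algebra.Properties.CommutativeSemigroup +-commutativeSemigroup using (interchange)
open import Data.List using (List; []; _∷_; length; take; drop; reverse; map; _++_; [_])
open import Data.List.Properties
  using (length-take; length-drop; length-reverse; take-[]; take-drop; drop-drop; take++drop≡id; reverse-++; reverse-involutive; unfold-reverse)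
open import Data.Maybe using (Maybe; just; nothing)
import Data.Maybe as Maybe
open import Data.Maybe.Properties using (just-injective; ≡-dec)
open import Data.Product using (Σ; _×_; _,_; proj₁; proj₂; map₁; map₂)
open import Data.Sum using (_⊎_; inj₁; inj₂)
open import Data.Empty using (⊥-elim)
open import Relation.Binary.PropositionalEquality
  using (_≡_; _≢_; refl; sym; trans; cong; cong₂; subst; subst₂; module ≡-Reasoning)
open import Relation.Binary.Definitions using (DecidableEquality)
open import Relation.Nullary using (yes; no)

take-+ : ∀ {B : Set} a b (T : List B) → take (a + b) T ≡ take a T ++ take b (drop a T)
take-+ zero    b T       = refl
take-+ (suc a) b []      = sym (take-[] b)
take-+ (suc a) b (t ∷ T) = cong (t ∷_) (take-+ a b T)

take-length-++ : ∀ {B : Set} (P Q : List B) → take (length P) (P ++ Q) ≡ P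
take-length-++ []      Q = refl
take-length-++ (p ∷ P) Q = cong (p ∷_) (take-length-++ P Q)

length-take-≤ : ∀ {B : Set} n (T : List B) → n ≤ length T → length (take n T) ≡ n
length-take-≤ n T n≤T = trans (length-take n T) (m≤n⇒m⊓n≡m n≤T)

reverse-take-reverse : ∀ {B : Set} a (T : List B) → a ≤ length T →
  reverse (take a (reverse T)) ≡ drop (length T ∸ a) T
reverse-take-reverse a T a≤T = begin
    reverse (take a (reverse T))
  ≡⟨ cong (λ Z → reverse (take a (reverse Z))) (sym (take++drop≡id c T)) ⟩
    reverse (take a (reverse (take c T ++ drop c T)))
  ≡⟨ cong (λ Z → reverse (take a Z)) (reverse-++ (take c T) (drop c T)) ⟩
    reverse (take a (reverse (drop c T) ++ reverse (take c T)))
  ≡⟨ cong (λ z → reverse (take z (reverse (drop c T) ++ reverse (take c T)))) (sym suffix-length) ⟩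
    reverse (take (length (reverse (drop c T))) (reverse (drop c T) ++ reverse (take c T)))
  ≡⟨ cong reverse (take-length-++ (reverse (drop c T)) (reverse (take c T))) ⟩
    reverse (reverse (drop c T))
  ≡⟨ reverse-involutive (drop c T) ⟩
    drop c T
  ∎
  where
    open ≡-Reasoning
    c : ℕ
    c = length T ∸ a
    suffix-length : length (reverse (drop c T)) ≡ a
    suffix-length = trans (length-reverse (drop c T)) (trans (length-drop c T) (m∸[m∸n]≡n a≤T))

-- The arms of T at split point n: (leftArm n T , rightArm n T) is the pair of Pairs_ℓ(T)
-- belonging to the (1-indexed) position n + 1.
leftArm : ∀ {B : Set} → ℕ → List B → List B
leftArm n T = reverse (take n T)

rightArm : ∀ {B : Set} → ℕ → List B → List B
rightArm n T = drop n T

length-leftArm : ∀ {B : Set} n (T : List B) → n ≤ length T → length (leftArm n T) ≡ n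
length-leftArm n T n≤T = trans (length-reverse (take n T)) (length-take-≤ n T n≤T)

window-arms : ∀ {B : Set} n a b (T : List B) → n ≤ length T → a ≤ n →
  take (a + b) (drop (n ∸ a) T) ≡ reverse (take a (leftArm n T)) ++ take b (rightArm n T)
window-arms n a b T n≤T a≤n = begin
    take (a + b) (drop (n ∸ a) T)
  ≡⟨ take-+ a b (drop (n ∸ a) T) ⟩
    take a (drop (n ∸ a) T) ++ take b (drop a (drop (n ∸ a) T))
  ≡⟨ cong₂ _++_ left right ⟩
    reverse (take a (leftArm n T)) ++ take b (rightArm n T)
  ∎
  where
    open ≡-Reasoning
    prefix-length : length (take n T) ≡ n
    prefix-length = length-take-≤ n T n≤T
    left : take a (drop (n ∸ a) T) ≡ reverse (take a (reverse (take n T)))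
    left = begin
        take a (drop (n ∸ a) T)
      ≡⟨ take-drop a (n ∸ a) T ⟩
        drop (n ∸ a) (take (n ∸ a + a) T)
      ≡⟨ cong (λ z → drop (n ∸ a) (take z T)) (m∸n+n≡m a≤n) ⟩
        drop (n ∸ a) (take n T)
      ≡⟨ cong (λ z → drop (z ∸ a) (take n T)) (sym prefix-length) ⟩
        drop (length (take n T) ∸ a) (take n T)
      ≡⟨ sym (reverse-take-reverse a (take n T) (subst (a ≤_) (sym prefix-length) a≤n)) ⟩
        reverse (take a (reverse (take n T)))
      ∎
    right : take b (drop a (drop (n ∸ a) T)) ≡ take b (drop n T)
    right = cong (take b) (trans (drop-drop (n ∸ a) a T) (cong (λ z → drop z T) (m∸n+n≡m a≤n)))

window-fits : ∀ {B : Set} n a b (T : List B) → n ≤ length T → a ≤ n → b ≤ length (rightArm n T) →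
  (n ∸ a) + (a + b) ≤ length T
window-fits n a b T n≤T a≤n b≤R = begin
  n ∸ a + (a + b)    ≡⟨ sym (+-assoc (n ∸ a) a b) ⟩
  n ∸ a + a + b      ≡⟨ cong (_+ b) (m∸n+n≡m a≤n) ⟩
  n + b              ≤⟨ +-monoʳ-≤ n (≤-trans b≤R (≤-reflexive (length-drop n T))) ⟩
  n + (length T ∸ n) ≡⟨ m+[n∸m]≡n n≤T ⟩
  length T           ∎
  where open ≤-Reasoning

window-room : ∀ {B : Set} i t m (T : List B) → i + m ≤ length T → t ≤ m →
  i + t ≤ length T × t ≤ length (leftArm (i + t) T) × m ∸ t ≤ length (rightArm (i + t) T)
window-room i t m T i+m≤T t≤m = i+t≤T , t≤left , room-right
  where
    open ≤-Reasoning
    i+t≤T : i + t ≤ length T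
    i+t≤T = ≤-trans (+-monoʳ-≤ i t≤m) i+m≤T
    t≤left : t ≤ length (leftArm (i + t) T)
    t≤left = ≤-trans (m≤n+m t i) (≤-reflexive (sym (length-leftArm (i + t) T i+t≤T)))
    room-right : m ∸ t ≤ length (rightArm (i + t) T)
    room-right = begin
      m ∸ t                  ≡⟨ sym ([m+n]∸[m+o]≡n∸o i m t) ⟩
      i + m ∸ (i + t)        ≤⟨ ∸-monoˡ-≤ (i + t) i+m≤T ⟩
      length T ∸ (i + t)     ≡⟨ sym (length-drop (i + t) T) ⟩
      length (drop (i + t) T) ∎

window-recentre : ∀ {B : Set} i t m (T : List B) → t ≤ m →
  take m (drop i T) ≡ take (t + (m ∸ t)) (drop (i + t ∸ t) T)
window-recentre i t m T t≤m =
  cong₂ (λ z w → take z (drop w T)) (sym (m+[n∸m]≡n t≤m)) (sym (m+n∸n≡m i t))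

at-ext : ∀ {B : Set} (xs ys : List B) → (∀ i → at xs i ≡ at ys i) → xs ≡ ys
at-ext []       []       same = refl
at-ext []       (y ∷ ys) same with same 0
... | ()
at-ext (x ∷ xs) []       same with same 0
... | ()
at-ext (x ∷ xs) (y ∷ ys) same = cong₂ _∷_ (just-injective (same 0)) (at-ext xs ys (λ i → same (suc i)))

at-map : ∀ {B C : Set} (f : B → C) (xs : List B) i → at (map f xs) i ≡ Maybe.map f (at xs i)
at-map f []       i       = refl
at-map f (x ∷ xs) zero    = refl
at-map f (x ∷ xs) (suc i) = at-map f xs i

module _ {B : Set} (eq : DecidableEquality B) where

  δ : B → B → ℕ
  δ a b = dH eq [ a ] [ b ]

  dH-∷ : ∀ a b xs ys → dH eq (a ∷ xs) (b ∷ ys) ≡ δ a b + dH eq xs ys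
  dH-∷ a b xs ys with eq a b
  ... | yes _ = refl
  ... | no  _ = refl

  δ-refl : ∀ a → δ a a ≡ 0
  δ-refl a with eq a a
  ... | yes _  = refl
  ... | no a≢a = ⊥-elim (a≢a refl)

  δ-≢ : ∀ a b → a ≢ b → δ a b ≡ 1
  δ-≢ a b a≢b with eq a b
  ... | yes a≡b = ⊥-elim (a≢b a≡b)
  ... | no  _   = refl

  δ≤1 : ∀ a b → δ a b ≤ 1
  δ≤1 a b with eq a b
  ... | yes _ = z≤n
  ... | no  _ = s≤s z≤n

  δ-triangle : ∀ a b c → δ a b ≤ δ a c + δ b c
  δ-triangle a b c with eq a c | eq b c
  ... | yes refl | yes refl = ≤-reflexive (δ-refl a)
  ... | yes refl | no  _    = δ≤1 a b
  ... | no  _    | _        = ≤-trans (δ≤1 a b) (m≤m+n 1 _)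

  dH-refl : ∀ xs → dH eq xs xs ≡ 0
  dH-refl []       = refl
  dH-refl (x ∷ xs) = trans (dH-∷ x x xs xs) (cong₂ _+_ (δ-refl x) (dH-refl xs))

  dH-++ : ∀ (P R : List B) {Q S} → length P ≡ length R → dH eq (P ++ Q) (R ++ S) ≡ dH eq P R + dH eq Q S
  dH-++ []      []      _   = refl
  dH-++ (a ∷ P) (c ∷ R) |P| with eq a c
  ... | yes _ = dH-++ P R (suc-injective |P|)
  ... | no  _ = cong suc (dH-++ P R (suc-injective |P|))

  dH-reverse : ∀ (P R : List B) → length P ≡ length R → dH eq (reverse P) (reverse R) ≡ dH eq P R
  dH-reverse []      []      _   = refl
  dH-reverse (a ∷ P) (c ∷ R) |P| = begin
      dH eq (reverse (a ∷ P)) (reverse (c ∷ R))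
    ≡⟨ cong₂ (dH eq) (unfold-reverse a P) (unfold-reverse c R) ⟩
      dH eq (reverse P ++ [ a ]) (reverse R ++ [ c ])
    ≡⟨ dH-++ (reverse P) (reverse R) reversed-lengths ⟩
      dH eq (reverse P) (reverse R) + dH eq [ a ] [ c ]
    ≡⟨ cong (_+ δ a c) (dH-reverse P R (suc-injective |P|)) ⟩
      dH eq P R + δ a c
    ≡⟨ +-comm (dH eq P R) (δ a c) ⟩
      δ a c + dH eq P R
    ≡⟨ sym (dH-∷ a c P R) ⟩
      dH eq (a ∷ P) (c ∷ R)
    ∎
    where
      open ≡-Reasoning
      reversed-lengths : length (reverse P) ≡ length (reverse R)
      reversed-lengths = trans (length-reverse P) (trans (suc-injective |P|) (sym (length-reverse R)))

  window-dH : ∀ n n' a b (X Y : List B) → n ≤ length X → n' ≤ length Y → a ≤ n → a ≤ n' →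
    dH eq (take (a + b) (drop (n ∸ a) X)) (take (a + b) (drop (n' ∸ a) Y))
      ≡ dH eq (take a (leftArm n X)) (take a (leftArm n' Y)) + dH eq (take b (rightArm n X)) (take b (rightArm n' Y))
  window-dH n n' a b X Y n≤X n'≤Y a≤n a≤n' = begin
      dH eq (take (a + b) (drop (n ∸ a) X)) (take (a + b) (drop (n' ∸ a) Y))
    ≡⟨ cong₂ (dH eq) (window-arms n a b X n≤X a≤n) (window-arms n' a b Y n'≤Y a≤n') ⟩
      dH eq (reverse LX ++ take b (rightArm n X)) (reverse LY ++ take b (rightArm n' Y))
    ≡⟨ dH-++ (reverse LX) (reverse LY) (trans (length-reverse LX) (trans same-length (sym (length-reverse LY)))) ⟩
      dH eq (reverse LX) (reverse LY) + dH eq (take b (rightArm n X)) (take b (rightArm n' Y))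
    ≡⟨ cong (_+ _) (dH-reverse LX LY same-length) ⟩
      dH eq LX LY + dH eq (take b (rightArm n X)) (take b (rightArm n' Y))
    ∎
    where
      open ≡-Reasoning
      LX LY : List B
      LX = take a (leftArm n X)
      LY = take a (leftArm n' Y)
      same-length : length LX ≡ length LY
      same-length = trans (length-take-≤ a (leftArm n X) (≤-trans a≤n (≤-reflexive (sym (length-leftArm n X n≤X)))))
                          (sym (length-take-≤ a (leftArm n' Y) (≤-trans a≤n' (≤-reflexive (sym (length-leftArm n' Y n'≤Y))))))

  window-cut-dH : ∀ i j t m (X Y : List B) → i + m ≤ length X → j + m ≤ length Y → t ≤ m →
    dH eq (take m (drop i X)) (take m (drop j Y))
      ≡ dH eq (take t (leftArm (i + t) X)) (take t (leftArm (j + t) Y))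
        + dH eq (take (m ∸ t) (rightArm (i + t) X)) (take (m ∸ t) (rightArm (j + t) Y))
  window-cut-dH i j t m X Y i+m≤X j+m≤Y t≤m = begin
      dH eq (take m (drop i X)) (take m (drop j Y))
    ≡⟨ cong₂ (dH eq) (window-recentre i t m X t≤m) (window-recentre j t m Y t≤m) ⟩
      dH eq (take (t + (m ∸ t)) (drop (i + t ∸ t) X)) (take (t + (m ∸ t)) (drop (j + t ∸ t) Y))
    ≡⟨ window-dH (i + t) (j + t) t (m ∸ t) X Y (proj₁ (window-room i t m X i+m≤X t≤m))
         (proj₁ (window-room j t m Y j+m≤Y t≤m)) (m≤n+m t i) (m≤n+m t j) ⟩
      dH eq (take t (leftArm (i + t) X)) (take t (leftArm (j + t) Y))
        + dH eq (take (m ∸ t) (rightArm (i + t) X)) (take (m ∸ t) (rightArm (j + t) Y))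
    ∎
    where open ≡-Reasoning

  LCP≤ˡ : ∀ xs ys → LCP eq xs ys ≤ length xs
  LCP≤ˡ []       ys       = z≤n
  LCP≤ˡ (x ∷ xs) []       = z≤n
  LCP≤ˡ (x ∷ xs) (y ∷ ys) with eq x y
  ... | yes _ = s≤s (LCP≤ˡ xs ys)
  ... | no  _ = z≤n

  LCP≤ʳ : ∀ xs ys → LCP eq xs ys ≤ length ys
  LCP≤ʳ []       ys       = z≤n
  LCP≤ʳ (x ∷ xs) []       = z≤n
  LCP≤ʳ (x ∷ xs) (y ∷ ys) with eq x y
  ... | yes _ = s≤s (LCP≤ʳ xs ys)
  ... | no  _ = z≤n

  LCP-≥ : ∀ p xs ys → p ≤ length xs → (∀ i → i < p → at xs i ≡ at ys i) → p ≤ LCP eq xs ys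
  LCP-≥ zero    xs       ys       _         _     = z≤n
  LCP-≥ (suc p) (x ∷ xs) []       _         agree with agree 0 (s≤s z≤n)
  ... | ()
  LCP-≥ (suc p) (x ∷ xs) (y ∷ ys) (s≤s p≤xs) agree with eq x y
  ... | yes _   = s≤s (LCP-≥ p xs ys p≤xs (λ i i<p → agree (suc i) (s≤s i<p)))
  ... | no  x≢y = ⊥-elim (x≢y (just-injective (agree 0 (s≤s z≤n))))

δ-just : ∀ {B : Set} (eq : DecidableEquality B) a b → δ (≡-dec eq) (just a) (just b) ≡ δ eq a b
δ-just eq a b with eq a b
... | yes _ = refl
... | no  _ = refl

isDollar : ∀ {B : Set} → Maybe B → ℕ
isDollar nothing  = 1
isDollar (just _) = 0

#$-∷ : ∀ {B : Set} (x : Maybe B) xs → #$ (x ∷ xs) ≡ isDollar x + #$ xs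
#$-∷ nothing  xs = refl
#$-∷ (just _) xs = refl

#$-map-just : ∀ {B : Set} (xs : List B) → #$ (map just xs) ≡ 0
#$-map-just []       = refl
#$-map-just (x ∷ xs) = #$-map-just xs

-- Every $ of a substitute G' of G is a position where G' differs from G.
#$≤dH : ∀ {B : Set} (eq : DecidableEquality B) (G : List B) G' → length G' ≡ length G →
  #$ G' ≤ dH (≡-dec eq) (map just G) G'
#$≤dH eq []      []             _    = z≤n
#$≤dH eq (g ∷ G) (nothing ∷ G') |G'| = s≤s (#$≤dH eq G G' (suc-injective |G'|))
#$≤dH eq (g ∷ G) (just x ∷ G')  |G'| = begin
  #$ G'                                                    ≤⟨ #$≤dH eq G G' (suc-injective |G'|) ⟩
  dH (≡-dec eq) (map just G) G'                            ≤⟨ m≤n+m _ _ ⟩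
  δ (≡-dec eq) (just g) (just x) + dH (≡-dec eq) (map just G) G' ≡⟨ sym (dH-∷ (≡-dec eq) (just g) (just x) (map just G) G') ⟩
  dH (≡-dec eq) (just g ∷ map just G) (just x ∷ G')        ∎
  where open ≤-Reasoning

cost-+ : ∀ a b c D dF dG {s p q} → 2 * a + s + s ≤ 2 * b + 2 * c → 2 * D + p + q ≤ 2 * dF + 2 * dG →
  2 * (a + D) + (s + p) + (s + q) ≤ 2 * (b + dF) + 2 * (c + dG)
cost-+ a b c D dF dG {s} {p} {q} head tail =
  subst₂ _≤_ (regroup-left a s D p q) (regroup-right b c dF dG) (+-mono-≤ head tail)
  where
    regroup-left : ∀ a s D p q → (2 * a + s + s) + (2 * D + p + q) ≡ 2 * (a + D) + (s + p) + (s + q)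
    regroup-left = solve-∀
    regroup-right : ∀ b c dF dG → (2 * b + 2 * c) + (2 * dF + 2 * dG) ≡ 2 * (b + dF) + 2 * (c + dG)
    regroup-right = solve-∀

summand-≤ˡ : ∀ {a b c} → a + b ≡ c → a ≤ c
summand-≤ˡ {a} {b} a+b≡c = ≤-trans (m≤m+n a b) (≤-reflexive a+b≡c)

summand-≤ʳ : ∀ {a b c} → a + b ≡ c → b ≤ c
summand-≤ʳ {a} {b} a+b≡c = ≤-trans (m≤n+m b a) (≤-reflexive a+b≡c)

budget-cut : ∀ {x y k} → x + y ≤ k → x ≤ k × y ≤ k ∸ x
budget-cut {x} {y} x+y≤k = ≤-trans (m≤m+n x y) x+y≤k , ≤-trans (≤-reflexive (sym (m+n∸m≡n x y))) (∸-monoˡ-≤ x x+y≤k)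

halves-≤ : ∀ x y {e₁ e₂ f₁ f₂ k} → 2 * x ≤ e₁ + f₁ → 2 * y ≤ e₂ + f₂ → (e₁ + e₂) + (f₁ + f₂) ≡ 2 * k → x + y ≤ k
halves-≤ x y {e₁} {e₂} {f₁} {f₂} {k} 2x≤ 2y≤ total = *-cancelˡ-≤ 2 (begin
  2 * (x + y)           ≡⟨ *-distribˡ-+ 2 x y ⟩
  2 * x + 2 * y         ≤⟨ +-mono-≤ 2x≤ 2y≤ ⟩
  (e₁ + f₁) + (e₂ + f₂) ≡⟨ interchange e₁ f₁ e₂ f₂ ⟩
  (e₁ + e₂) + (f₁ + f₂) ≡⟨ total ⟩
  2 * k                 ∎)
  where open ≤-Reasoning

isMax-squeeze : ∀ {P : ℕ → Set} {L} → (∀ m → P m → m ≤ L) → (Σ ℕ λ v → L ≤ v × P v) → IsMax P L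
isMax-squeeze {P} bounded (v , L≤v , Pv) = subst P (≤-antisym (bounded v Pv) L≤v) Pv , bounded

module _ {A : Set} (_≟_ : DecidableEquality A) where

  private
    eq$ : DecidableEquality (Maybe A)
    eq$ = _≟$_ _≟_

  -- F' ∈ N_{d,e/2}(F), apart from membership in N(F): F' has the length of F, at most d edits,
  -- and d_H(F,F') − #$(F')/2 ≤ e/2.
  record WithinBudget (d e : ℕ) (F : List A) (F' : List (Maybe A)) : Set where
    constructor within
    field
      same-length   : length F' ≡ length F
      edits≤        : dH eq$ (map just F) F' ≤ d
      symbol-edits≤ : 2 * dH eq$ (map just F) F' ≤ e + #$ F'

  open WithinBudget

  InNdd⇒within : ∀ {N d e F F'} → InNdd _≟_ N d e F F' → WithinBudget d e F F'
  InNdd⇒within (_ , |F'| , edits , symbol-edits) = within |F'| edits symbol-edits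

  within⇒InNdd : ∀ {N : List A → List (Maybe A) → Set} {d e F F'} → N F F' → WithinBudget d e F F' → InNdd _≟_ N d e F F'
  within⇒InNdd NF (within |F'| edits symbol-edits) = NF , |F'| , edits , symbol-edits

  -- Where substitutes carry a common symbol x over f and g, a mismatch of f, g costs two
  -- edits, and a $ costs one edit on each side.
  symbol-cost : ∀ f g x → 2 * δ _≟_ f g + isDollar x + isDollar x ≤ 2 * δ eq$ (just f) x + 2 * δ eq$ (just g) x
  symbol-cost f g nothing  = +-monoˡ-≤ 1 (+-monoˡ-≤ 1 (*-monoʳ-≤ 2 (δ≤1 _≟_ f g)))
  symbol-cost f g (just c) = begin
    2 * δ _≟_ f g + 0 + 0                            ≡⟨ trans (+-identityʳ _) (+-identityʳ _) ⟩
    2 * δ _≟_ f g                                    ≤⟨ *-monoʳ-≤ 2 (δ-triangle _≟_ f g c) ⟩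
    2 * (δ _≟_ f c + δ _≟_ g c)                      ≡⟨ *-distribˡ-+ 2 (δ _≟_ f c) (δ _≟_ g c) ⟩
    2 * δ _≟_ f c + 2 * δ _≟_ g c                    ≡⟨ sym (cong₂ (λ u w → 2 * u + 2 * w) (δ-just _≟_ f c) (δ-just _≟_ g c)) ⟩
    2 * δ eq$ (just f) (just c) + 2 * δ eq$ (just g) (just c) ∎
    where open ≤-Reasoning

  dollar-cost : ∀ F G F' G' → length F' ≡ length F → length G' ≡ length G →
    #$ F' + #$ G' ≤ 2 * dH eq$ (map just F) F' + 2 * dH eq$ (map just G) G'
  dollar-cost F G F' G' |F'| |G'| =
    +-mono-≤ (≤-trans (#$≤dH _≟_ F F' |F'|) (m≤m+n _ _)) (≤-trans (#$≤dH _≟_ G G' |G'|) (m≤m+n _ _))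

  -- Summing symbol-cost over the common prefix of F', G' and dollar-cost beyond it: hiding the
  -- mismatches of F, G under a common prefix is paid for by edits.
  lcp-cost : ∀ F G F' G' → length F' ≡ length F → length G' ≡ length G →
    2 * dH _≟_ (take (LCP eq$ F' G') F) (take (LCP eq$ F' G') G) + #$ F' + #$ G'
      ≤ 2 * dH eq$ (map just F) F' + 2 * dH eq$ (map just G) G'
  lcp-cost F       G       []       G'       |F'| |G'| = dollar-cost F G [] G' |F'| |G'|
  lcp-cost F       G       (x ∷ F') []       |F'| |G'| = dollar-cost F G (x ∷ F') [] |F'| |G'|
  lcp-cost []      G       (x ∷ F') (y ∷ G') ()   |G'|
  lcp-cost (f ∷ F) []      (x ∷ F') (y ∷ G') |F'| ()
  lcp-cost (f ∷ F) (g ∷ G) (x ∷ F') (y ∷ G') |F'| |G'| with eq$ x y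
  ... | no  _    = dollar-cost (f ∷ F) (g ∷ G) (x ∷ F') (y ∷ G') |F'| |G'|
  ... | yes refl = subst₂ _≤_ (sym split-left) (sym split-right)
                     (cost-+ (δ _≟_ f g) (δ eq$ (just f) x) (δ eq$ (just g) x)
                             (dH _≟_ (take p F) (take p G)) (dH eq$ (map just F) F') (dH eq$ (map just G) G')
                             (symbol-cost f g x) (lcp-cost F G F' G' (suc-injective |F'|) (suc-injective |G'|)))
    where
      p : ℕ
      p = LCP eq$ F' G'
      split-left : 2 * dH _≟_ (f ∷ take p F) (g ∷ take p G) + #$ (x ∷ F') + #$ (x ∷ G')
                 ≡ 2 * (δ _≟_ f g + dH _≟_ (take p F) (take p G)) + (isDollar x + #$ F') + (isDollar x + #$ G')
      split-left = cong₂ _+_ (cong₂ _+_ (cong (2 *_) (dH-∷ _≟_ f g _ _)) (#$-∷ x F')) (#$-∷ x G')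
      split-right : 2 * dH eq$ (just f ∷ map just F) (x ∷ F') + 2 * dH eq$ (just g ∷ map just G) (x ∷ G')
                  ≡ 2 * (δ eq$ (just f) x + dH eq$ (map just F) F') + 2 * (δ eq$ (just g) x + dH eq$ (map just G) G')
      split-right = cong₂ _+_ (cong (2 *_) (dH-∷ eq$ (just f) x _ _)) (cong (2 *_) (dH-∷ eq$ (just g) x _ _))

  budget-lcp-mismatches : ∀ {d d' e f F G F' G'} → WithinBudget d e F F' → WithinBudget d' f G G' →
    2 * dH _≟_ (take (LCP eq$ F' G') F) (take (LCP eq$ F' G') G) ≤ e + f
  budget-lcp-mismatches {e = e} {f} {F} {G} {F'} {G'} (within |F'| _ costF) (within |G'| _ costG) =
    +-cancelʳ-≤ (#$ F' + #$ G') _ _ (begin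
      2 * D + (#$ F' + #$ G')                                  ≡⟨ sym (+-assoc (2 * D) _ _) ⟩
      2 * D + #$ F' + #$ G'                                    ≤⟨ lcp-cost F G F' G' |F'| |G'| ⟩
      2 * dH eq$ (map just F) F' + 2 * dH eq$ (map just G) G'  ≤⟨ +-mono-≤ costF costG ⟩
      (e + #$ F') + (f + #$ G')                                ≡⟨ interchange e (#$ F') f (#$ G') ⟩
      (e + f) + (#$ F' + #$ G')                                ∎)
    where
      open ≤-Reasoning
      D : ℕ
      D = dH _≟_ (take (LCP eq$ F' G') F) (take (LCP eq$ F' G') G)

  arms-window : ∀ {k n n' d₁ d₂ d₁' d₂' e₁ e₂ f₁ f₂} {X Y P₁ P₂ Q₁ Q₂} → n ≤ length X → n' ≤ length Y →
    WithinBudget d₁ e₁ (leftArm n X) P₁ → WithinBudget d₂ e₂ (rightArm n X) P₂ →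
    WithinBudget d₁' f₁ (leftArm n' Y) Q₁ → WithinBudget d₂' f₂ (rightArm n' Y) Q₂ →
    (e₁ + e₂) + (f₁ + f₂) ≡ 2 * k →
    HasCommonFactor _≟_ k X Y (LCP eq$ P₁ Q₁ + LCP eq$ P₂ Q₂)
  arms-window {k} {n} {n'} {e₁ = e₁} {e₂} {f₁} {f₂} {X} {Y} {P₁} {P₂} {Q₁} {Q₂} n≤X n'≤Y wP₁ wP₂ wQ₁ wQ₂ total =
    n ∸ a , n' ∸ a , window-fits n a b X n≤X a≤n b≤X , window-fits n' a b Y n'≤Y a≤n' b≤Y ,
    subst (_≤ k) (sym (window-dH _≟_ n n' a b X Y n≤X n'≤Y a≤n a≤n'))
      (halves-≤ left right {e₁} {e₂} {f₁} {f₂} (budget-lcp-mismatches wP₁ wQ₁) (budget-lcp-mismatches wP₂ wQ₂) total)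
    where
      a b left right : ℕ
      a = LCP eq$ P₁ Q₁
      b = LCP eq$ P₂ Q₂
      left  = dH _≟_ (take a (leftArm n X)) (take a (leftArm n' Y))
      right = dH _≟_ (take b (rightArm n X)) (take b (rightArm n' Y))
      a≤n : a ≤ n
      a≤n = ≤-trans (LCP≤ˡ eq$ P₁ Q₁) (≤-reflexive (trans (same-length wP₁) (length-leftArm n X n≤X)))
      a≤n' : a ≤ n'
      a≤n' = ≤-trans (LCP≤ʳ eq$ P₁ Q₁) (≤-reflexive (trans (same-length wQ₁) (length-leftArm n' Y n'≤Y)))
      b≤X : b ≤ length (rightArm n X)
      b≤X = ≤-trans (LCP≤ˡ eq$ P₂ Q₂) (≤-reflexive (same-length wP₂))
      b≤Y : b ≤ length (rightArm n' Y)
      b≤Y = ≤-trans (LCP≤ʳ eq$ P₂ Q₂) (≤-reflexive (same-length wQ₂))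

  pairValue⇒commonFactor : ∀ {S N X Y k m} → PairValue _≟_ S N X Y k m → HasCommonFactor _≟_ k X Y m
  pairValue⇒commonFactor {N = N}
    (_ , _ , total , _ , _ ,
     (_ , _ , (i , _ , _ , i≤X , refl) , _ , _ , _ , _ , _ , refl , _ , _ , P₁∈N , P₂∈N) ,
     (_ , _ , (j , _ , _ , j≤Y , refl) , _ , _ , _ , _ , _ , refl , _ , _ , Q₁∈N , Q₂∈N) ,
     refl) =
    arms-window (≤-trans (m∸n≤m i 1) i≤X) (≤-trans (m∸n≤m j 1) j≤Y)
      (InNdd⇒within {N} P₁∈N) (InNdd⇒within {N} P₂∈N) (InNdd⇒within {N} Q₁∈N) (InNdd⇒within {N} Q₂∈N) total

  Unchanged : ℕ → List A → List A → List (Maybe A) → List (Maybe A) → Set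
  Unchanged p U V U' V' = ∀ i → (p ≤ i ⊎ at U i ≡ at V i) →
    at U' i ≡ Maybe.map just (at U i) × at V' i ≡ Maybe.map just (at V i)

  Merged : ℕ → List A → List A → List (Maybe A) → List (Maybe A) → Set
  Merged p U V U' V' = ∀ i → i < p → at U i ≢ at V i →
    at U' i ≡ at V' i ×
    (at U' i ≡ Maybe.map just (at U i) ⊎ at U' i ≡ Maybe.map just (at V i) ⊎ at U' i ≡ just nothing)

  merged-agree : ∀ p U V U' V' → Unchanged p U V U' V' → Merged p U V U' V' → ∀ i → i < p → at U' i ≡ at V' i
  merged-agree p U V U' V' unchanged merged i i<p with ≡-dec _≟_ (at U i) (at V i)
  ... | no  differ = proj₁ (merged i i<p differ)
  ... | yes same   = begin
    at U' i                  ≡⟨ proj₁ (unchanged i (inj₂ same)) ⟩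
    Maybe.map just (at U i)  ≡⟨ cong (Maybe.map just) same ⟩
    Maybe.map just (at V i)  ≡⟨ sym (proj₂ (unchanged i (inj₂ same))) ⟩
    at V' i                  ∎
    where open ≡-Reasoning

  unchanged-everywhere : ∀ U V U' V' → Unchanged 0 U V U' V' → U' ≡ map just U × V' ≡ map just V
  unchanged-everywhere U V U' V' unchanged =
    at-ext U' (map just U) (λ i → trans (proj₁ (unchanged i (inj₁ z≤n))) (sym (at-map just U i))) ,
    at-ext V' (map just V) (λ i → trans (proj₂ (unchanged i (inj₁ z≤n))) (sym (at-map just V i)))

  -- Bookkeeping of a (U,V)_d-pair over a prefix containing m mismatches of U and V: U' makes
  -- dU edits, sU of them to $, and 2dU = cU + sU; likewise for V'.  Each mismatch is resolved
  -- at cost (cU, cV) = (0, 2), (2, 0) or (1, 1), so the shares cU, cV add up to 2m.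
  record Budget (m dU dV sU sV : ℕ) : Set where
    constructor budget
    field
      cU cV  : ℕ
      shares : cU + cV ≡ 2 * m
      costU  : 2 * dU ≡ cU + sU
      costV  : 2 * dV ≡ cV + sV
      dU≤m   : dU ≤ m
      dV≤m   : dV ≤ m

  Budget-+ : ∀ {m dU dV sU sV m' dU' dV' sU' sV'} → Budget m dU dV sU sV → Budget m' dU' dV' sU' sV' →
    Budget (m + m') (dU + dU') (dV + dV') (sU + sU') (sV + sV')
  Budget-+ {m} {dU} {dV} {sU} {sV} {m'} {dU'} {dV'} {sU'} {sV'}
    (budget cU cV shares costU costV dU≤m dV≤m) (budget cU' cV' shares' costU' costV' dU'≤m' dV'≤m') =
    budget (cU + cU') (cV + cV')
      (trans (interchange cU cU' cV cV') (trans (cong₂ _+_ shares shares') (sym (*-distribˡ-+ 2 m m'))))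
      (trans (*-distribˡ-+ 2 dU dU') (trans (cong₂ _+_ costU costU') (interchange cU sU cU' sU')))
      (trans (*-distribˡ-+ 2 dV dV') (trans (cong₂ _+_ costV costV') (interchange cV sV cV' sV')))
      (+-mono-≤ dU≤m dU'≤m') (+-mono-≤ dV≤m dV'≤m')

  Budget-cast : ∀ {m dU dV sU sV m' dU' dV' sU' sV'} → m ≡ m' → dU ≡ dU' → dV ≡ dV' → sU ≡ sU' → sV ≡ sV' →
    Budget m dU dV sU sV → Budget m' dU' dV' sU' sV'
  Budget-cast refl refl refl refl refl b = b

  position-budget : ∀ u v u' v' → (u ≡ v → u' ≡ just u × v' ≡ just v) →
    (u ≢ v → u' ≡ v' × (u' ≡ just u ⊎ u' ≡ just v ⊎ u' ≡ nothing)) →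
    Budget (δ _≟_ u v) (δ eq$ (just u) u') (δ eq$ (just v) v') (isDollar u') (isDollar v')
  position-budget u v u' v' copied resolved with u ≟ v
  ... | yes refl with copied refl
  ...   | refl , refl rewrite δ-refl eq$ (just u) = budget 0 0 refl refl refl z≤n z≤n
  position-budget u v u' v' copied resolved | no u≢v with resolved u≢v
  ...   | refl , inj₁ refl rewrite δ-refl eq$ (just u) | δ-just _≟_ v u | δ-≢ _≟_ v u (λ v≡u → u≢v (sym v≡u)) =
    budget 0 2 refl refl refl z≤n ≤-refl
  ...   | refl , inj₂ (inj₁ refl) rewrite δ-refl eq$ (just v) | δ-just _≟_ u v | δ-≢ _≟_ u v u≢v =
    budget 2 0 refl refl refl ≤-refl z≤n
  ...   | refl , inj₂ (inj₂ refl) = budget 1 1 refl refl refl ≤-refl ≤-refl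

  dpair-budget : ∀ p U V U' V' → p ≤ length U → p ≤ length V → length U' ≡ length U → length V' ≡ length V →
    Unchanged p U V U' V' → Merged p U V U' V' →
    Budget (dH _≟_ (take p U) (take p V)) (dH eq$ (map just U) U') (dH eq$ (map just V) V') (#$ U') (#$ V')
  dpair-budget zero U V U' V' _ _ _ _ unchanged _ with unchanged-everywhere U V U' V' unchanged
  ... | refl , refl rewrite dH-refl eq$ (map just U) | dH-refl eq$ (map just V) | #$-map-just U | #$-map-just V =
    budget 0 0 refl refl refl z≤n z≤n
  dpair-budget (suc p) (u ∷ U) (v ∷ V) []        V'        _ _ () _ _ _
  dpair-budget (suc p) (u ∷ U) (v ∷ V) (u' ∷ U') []        _ _ _ () _ _
  dpair-budget (suc p) (u ∷ U) (v ∷ V) (u' ∷ U') (v' ∷ V') (s≤s p≤U) (s≤s p≤V) |U'| |V'| unchanged merged =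
    Budget-cast (sym (dH-∷ _≟_ u v _ _)) (sym (dH-∷ eq$ (just u) u' _ _)) (sym (dH-∷ eq$ (just v) v' _ _))
                (sym (#$-∷ u' U')) (sym (#$-∷ v' V'))
      (Budget-+ (position-budget u v u' v' copied resolved)
                (dpair-budget p U V U' V' p≤U p≤V (suc-injective |U'|) (suc-injective |V'|) unchanged-tail merged-tail))
    where
      copied : u ≡ v → u' ≡ just u × v' ≡ just v
      copied u≡v with unchanged 0 (inj₂ (cong just u≡v))
      ... | u'≡u , v'≡v = just-injective u'≡u , just-injective v'≡v
      resolved : u ≢ v → u' ≡ v' × (u' ≡ just u ⊎ u' ≡ just v ⊎ u' ≡ nothing)
      resolved u≢v with merged 0 (s≤s z≤n) (λ ju≡jv → u≢v (just-injective ju≡jv))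
      ... | same , inj₁ e        = just-injective same , inj₁ (just-injective e)
      ... | same , inj₂ (inj₁ e) = just-injective same , inj₂ (inj₁ (just-injective e))
      ... | same , inj₂ (inj₂ e) = just-injective same , inj₂ (inj₂ (just-injective e))
      unchanged-tail : Unchanged p U V U' V'
      unchanged-tail i (inj₁ p≤i)  = unchanged (suc i) (inj₁ (s≤s p≤i))
      unchanged-tail i (inj₂ same) = unchanged (suc i) (inj₂ same)
      merged-tail : Merged p U V U' V'
      merged-tail i i<p = merged (suc i) (s≤s i<p)

  record BudgetSplit (d : ℕ) (U V : List A) (U' V' : List (Maybe A)) : Set where
    constructor split
    field
      eU eV    : ℕ
      total    : eU + eV ≡ 2 * d
      U-within : WithinBudget d eU U U'
      V-within : WithinBudget d eV V V'

  -- A budget over m ≤ d mismatches yields a split of 2d, the slack going to V'.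
  pad-budget : ∀ {m d U V U' V'} → m ≤ d → length U' ≡ length U → length V' ≡ length V →
    Budget m (dH eq$ (map just U) U') (dH eq$ (map just V) V') (#$ U') (#$ V') → BudgetSplit d U V U' V'
  pad-budget {m} {d} {V' = V'} m≤d |U'| |V'| (budget cU cV shares costU costV dU≤m dV≤m) =
    split cU (cV + 2 * (d ∸ m)) total
      (within |U'| (≤-trans dU≤m m≤d) (≤-reflexive costU))
      (within |V'| (≤-trans dV≤m m≤d) (≤-trans (≤-reflexive costV) (+-monoˡ-≤ (#$ V') (m≤m+n cV _))))
    where
      open ≡-Reasoning
      total : cU + (cV + 2 * (d ∸ m)) ≡ 2 * d
      total = begin
        cU + (cV + 2 * (d ∸ m))  ≡⟨ sym (+-assoc cU cV _) ⟩
        cU + cV + 2 * (d ∸ m)    ≡⟨ cong (_+ 2 * (d ∸ m)) shares ⟩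
        2 * m + 2 * (d ∸ m)      ≡⟨ sym (*-distribˡ-+ 2 m (d ∸ m)) ⟩
        2 * (m + (d ∸ m))        ≡⟨ cong (2 *_) (m+[n∸m]≡n m≤d) ⟩
        2 * d                    ∎

  dpair-split : ∀ {U V d U' V'} q → IsDPair _≟_ U V d U' V' →
    q ≤ length U → q ≤ length V → dH _≟_ (take q U) (take q V) ≤ d →
    q ≤ LCP eq$ U' V' × BudgetSplit d U V U' V'
  dpair-split {U} {V} {U' = U'} {V'} q (|U'| , |V'| , p , ((p≤U , p≤V , m≤d) , maximal) , unchanged , merged) q≤U q≤V q≤d =
    ≤-trans (maximal q (q≤U , q≤V , q≤d))
            (LCP-≥ eq$ p U' V' (subst (p ≤_) (sym |U'|) p≤U) (merged-agree p U V U' V' unchanged merged)) ,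
    pad-budget m≤d |U'| |V'| (dpair-budget p U V U' V' p≤U p≤V |U'| |V'| unchanged merged)

  combine : ∀ {S N X Y k d U₁ U₂ V₁ V₂ U₁' U₂' V₁' V₂'} → d ≤ k →
    InPairs _≟_ S X (U₁ , U₂) → InPairs _≟_ S Y (V₁ , V₂) →
    N U₁ U₁' → N V₁ V₁' → N U₂ U₂' → N V₂ V₂' →
    BudgetSplit d U₁ V₁ U₁' V₁' → BudgetSplit (k ∸ d) U₂ V₂ U₂' V₂' →
    PairValue _≟_ S N X Y k (LCP eq$ U₁' V₁' + LCP eq$ U₂' V₂')
  combine {N = N} {k = k} {d} d≤k inX inY U₁∈N V₁∈N U₂∈N V₂∈N
    (split eU₁ eV₁ total₁ wU₁ wV₁) (split eU₂ eV₂ total₂ wU₂ wV₂) =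
    eU₁ + eU₂ , eV₁ + eV₂ , total , _ , _ ,
    (_ , _ , inX , d , k ∸ d , eU₁ , eU₂ , m+[n∸m]≡n d≤k , refl ,
     summand-≤ˡ total₁ , summand-≤ˡ total₂ , within⇒InNdd {N} U₁∈N wU₁ , within⇒InNdd {N} U₂∈N wU₂) ,
    (_ , _ , inY , d , k ∸ d , eV₁ , eV₂ , m+[n∸m]≡n d≤k , refl ,
     summand-≤ʳ total₁ , summand-≤ʳ total₂ , within⇒InNdd {N} V₁∈N wV₁ , within⇒InNdd {N} V₂∈N wV₂) ,
    refl
    where
      open ≡-Reasoning
      total : (eU₁ + eU₂) + (eV₁ + eV₂) ≡ 2 * k
      total = begin
        (eU₁ + eU₂) + (eV₁ + eV₂)  ≡⟨ interchange eU₁ eU₂ eV₁ eV₂ ⟩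
        (eU₁ + eV₁) + (eU₂ + eV₂)  ≡⟨ cong₂ _+_ total₁ total₂ ⟩
        2 * d + 2 * (k ∸ d)        ≡⟨ sym (*-distribˡ-+ 2 d (k ∸ d)) ⟩
        2 * (d + (k ∸ d))          ≡⟨ cong (2 *_) (m+[n∸m]≡n d≤k) ⟩
        2 * k                      ∎

  anchors-attain : ∀ {S N X Y k d a b U₁ U₂ V₁ V₂} → KComplete _≟_ S X Y k N →
    InPairs _≟_ S X (U₁ , U₂) → InPairs _≟_ S Y (V₁ , V₂) →
    a ≤ length U₁ → a ≤ length V₁ → b ≤ length U₂ → b ≤ length V₂ → d ≤ k →
    dH _≟_ (take a U₁) (take a V₁) ≤ d → dH _≟_ (take b U₂) (take b V₂) ≤ k ∸ d →
    Σ ℕ λ v → a + b ≤ v × PairValue _≟_ S N X Y k v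
  anchors-attain {k = k} {d} {a} {b} {U₁} {U₂} {V₁} {V₂} complete inX inY a≤U₁ a≤V₁ b≤U₂ b≤V₂ d≤k left≤ right≤
    with complete U₁ V₁ (_ , inj₁ inX , inj₁ refl) (_ , inj₂ inY , inj₁ refl) d d≤k
       | complete U₂ V₂ (_ , inj₁ inX , inj₂ refl) (_ , inj₂ inY , inj₂ refl) (k ∸ d) (m∸n≤m k d)
  ... | U₁' , V₁' , pair₁ , U₁∈N , V₁∈N | U₂' , V₂' , pair₂ , U₂∈N , V₂∈N
    with dpair-split a pair₁ a≤U₁ a≤V₁ left≤ | dpair-split b pair₂ b≤U₂ b≤V₂ right≤
  ... | a≤LCP₁ , split₁ | b≤LCP₂ , split₂ =
    _ , +-mono-≤ a≤LCP₁ b≤LCP₂ , combine d≤k inX inY U₁∈N V₁∈N U₂∈N V₂∈N split₁ split₂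

  cut-attains : ∀ {S N X Y k m} i j t → KComplete _≟_ S X Y k N →
    i + m ≤ length X → j + m ≤ length Y → dH _≟_ (take m (drop i X)) (take m (drop j Y)) ≤ k →
    t < m → S (suc (i + t)) → S (suc (j + t)) → Σ ℕ λ v → m ≤ v × PairValue _≟_ S N X Y k v
  cut-attains {S} {X = X} {Y} {k} {m} i j t complete i+m≤X j+m≤Y mismatches t<m i+t∈S j+t∈S =
    map₂ (map₁ (subst (_≤ _) (m+[n∸m]≡n t≤m)))
      (anchors-attain complete inX inY
        (proj₁ (proj₂ roomX)) (proj₁ (proj₂ roomY)) (proj₂ (proj₂ roomX)) (proj₂ (proj₂ roomY))
        (proj₁ cut) ≤-refl (proj₂ cut))
    where
      t≤m : t ≤ m
      t≤m = <⇒≤ t<m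
      roomX : i + t ≤ length X × t ≤ length (leftArm (i + t) X) × m ∸ t ≤ length (rightArm (i + t) X)
      roomX = window-room i t m X i+m≤X t≤m
      roomY : j + t ≤ length Y × t ≤ length (leftArm (j + t) Y) × m ∸ t ≤ length (rightArm (j + t) Y)
      roomY = window-room j t m Y j+m≤Y t≤m
      cut : dH _≟_ (take t (leftArm (i + t) X)) (take t (leftArm (j + t) Y)) ≤ k
          × dH _≟_ (take (m ∸ t) (rightArm (i + t) X)) (take (m ∸ t) (rightArm (j + t) Y))
              ≤ k ∸ dH _≟_ (take t (leftArm (i + t) X)) (take t (leftArm (j + t) Y))
      cut = budget-cut (subst (_≤ k) (window-cut-dH _≟_ i j t m X Y i+m≤X j+m≤Y t≤m) mismatches)
      cut-inside : ∀ (T : List A) i → i + m ≤ length T → suc (i + t) ≤ length T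
      cut-inside T i i+m≤T = ≤-trans (≤-reflexive (sym (+-suc i t))) (≤-trans (+-monoʳ-≤ i t<m) i+m≤T)
      inX : InPairs _≟_ S X (leftArm (i + t) X , rightArm (i + t) X)
      inX = suc (i + t) , i+t∈S , s≤s z≤n , cut-inside X i i+m≤X , refl
      inY : InPairs _≟_ S Y (leftArm (j + t) Y , rightArm (j + t) Y)
      inY = suc (j + t) , j+t∈S , s≤s z≤n , cut-inside Y j j+m≤Y , refl

  -- Lower bound: the cover provides the common offset t < ℓ ≤ m.
  commonFactor-attained : ∀ {S N X Y k ℓ m} → IsCover ℓ S → KComplete _≟_ S X Y k N →
    HasCommonFactor _≟_ k X Y m → ℓ ≤ m → Σ ℕ λ v → m ≤ v × PairValue _≟_ S N X Y k v
  commonFactor-attained (offset , cover) complete (i , j , i+m≤X , j+m≤Y , mismatches) ℓ≤m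
    with cover (suc i) (suc j) (s≤s z≤n) (s≤s z≤n)
  ... | t<ℓ , i+t∈S , j+t∈S =
    cut-attains i j (offset (suc i) (suc j)) complete i+m≤X j+m≤Y mismatches (≤-trans t<ℓ ℓ≤m) i+t∈S j+t∈S

corollary15 : {Alph : Set} (_≟_ : DecidableEquality Alph) (X Y : List Alph) (k ℓ : ℕ) →
    1 ≤ ℓ → (S : ℕ → Set) → IsCover ℓ S →
    (N : List Alph → List (Maybe Alph) → Set) → KComplete _≟_ S X Y k N →
    (L : ℕ) → IsMax (HasCommonFactor _≟_ k X Y) L → ℓ ≤ L →
    IsMax (PairValue _≟_ S N X Y k) L
corollary15 _≟_ X Y k ℓ _ S cover N complete L (L-common , L-maximal) ℓ≤L =
  isMax-squeeze
    (λ m m-value → L-maximal m (pairValue⇒commonFactor _≟_ {S} {N} {X} {Y} {k} m-value))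
    (commonFactor-attained _≟_ {S} {N} {X} {Y} {k} cover complete L-common ℓ≤L)
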